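{- Let $G=(V,E)$ be a finite simple undirected connected graph with $n$ vertices and degeneracy $\alpha$. The worst-case running time of the procedure SCTBuilder on $G$ (described in the context) is $O(n\,3^{\alpha/3})$.
   Context: The degeneracy $\alpha$ of $G$ is the maximum out-degree in a degeneracy orientation, i.e. the acyclic orientation obtained from the ordering given by repeatedly removing a minimum-degree vertex; $N^+(v)$ is the out-neighborhood of $v$ in this orientation. For $S\subseteq V$, $N(S,v)=N(v)\cap S$. SCTBuilder builds a rooted tree: it computes a degeneracy orientation, creates a root labeled $V$ and, for each $v\in V$, a child labeled $N^+(v)$. Then each non-root node with label $S$ is processed: if $S=\emptyset$ it is a leaf; otherwise a vertex $p\in S$ maximizing $|N(S,p)|$ is chosen (by building the subgraph induced on $S$), a child labeled $N(S,p)$ is created, and, writing $S\setminus(\{p\}\cup N(p))=\{v_1,\dots,v_\ell\}$, for each $i\le\ell$ a child labeled $N(S,v_i)\setminus\{v_1,\dots,v_{i-1}\}$ is created; all created nodes are processed recursively in the same way. Processing a non-root node labeled $S$, apart from processing its children, takes $O(|S|^2)$ time. -}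

module Defs where

open import Data.Nat using (ℕ; zero; suc; _+_; _*_; _≤_; _⊔_)
open import Data.Bool using (Bool; true; false)
open import Data.Fin using (Fin)
open import Data.Fin.Subset using (Subset; _∈_; _∉_; _∩_; _∪_; _─_; _-_; ∣_∣; ⊥; ⊤; ⁅_⁆)
open import Data.Vec using (tabulate)
open import Data.List using (List; []; _∷_; map; foldr; allFin)
open import Data.Nat.ListAction using (sum)
open import Data.List.Relation.Unary.Unique.Propositional using (Unique)
import Data.List.Membership.Propositional as L
open import Data.Product using (_×_; _,_; proj₁; proj₂)
open import Relation.Binary.PropositionalEquality using (_≡_; _≢_)
open import Function using (_∘_)

record Graph (n : ℕ) : Set where
  field
    adj     : Fin n → Fin n → Bool
    adj-sym : ∀ u v → adj u v ≡ adj v u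
    adj-irr : ∀ v → adj v v ≡ false
open Graph public

module _ {n : ℕ} (G : Graph n) where

  N : Fin n → Subset n
  N v = tabulate (adj G v)

  NS : Subset n → Fin n → Subset n
  NS S v = N v ∩ S

  data Reach : Fin n → Fin n → Set where
    here : ∀ {v} → Reach v v
    step : ∀ {u w v} → adj G u w ≡ true → Reach w v → Reach u v

  Connected : Set
  Connected = ∀ u v → Reach u v

  -- A degeneracy ordering of the remaining vertex set R: repeatedly remove a
  -- vertex of minimum degree in the subgraph induced on R.  Each removed
  -- vertex v is recorded together with its out-neighbourhood N⁺(v), i.e. its
  -- neighbours still present when it is removed.
  data DegOrd : Subset n → List (Fin n × Subset n) → Set where
    done : DegOrd ⊥ []
    next : ∀ {R ord} (v : Fin n) →
           v ∈ R →
           (∀ u → u ∈ R → ∣ NS R v ∣ ≤ ∣ NS R u ∣) →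
           DegOrd (R - v) ord →
           DegOrd R ((v , NS R v) ∷ ord)

  -- degeneracy = maximum out-degree in the degeneracy orientation
  maxOutDeg : List (Fin n × Subset n) → ℕ
  maxOutDeg ord = foldr _⊔_ 0 (map (∣_∣ ∘ proj₂) ord)

  -- Runs of SCTBuilder.  `Proc S c` : some valid execution of processing
  -- the non-root node labelled S (including all its descendants) has cost c,
  -- where processing the node itself costs ∣S∣² + 1.
  -- `ProcList S P vs c` : processing the children labelled
  -- N(S,v_i) ∖ {v_1..v_{i-1}} for the remaining list vs, where P is the set
  -- {v_1,..,v_{i-1}} of already handled vertices, costs c in total.
  data Proc : Subset n → ℕ → Set
  data ProcList : Subset n → Subset n → List (Fin n) → ℕ → Set

  data Proc where
    leaf   : Proc ⊥ 1
    branch : ∀ {S c₀ c₁} (p : Fin n) →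
             p ∈ S →
             (∀ u → u ∈ S → ∣ NS S u ∣ ≤ ∣ NS S p ∣) →
             (vs : List (Fin n)) →
             Unique vs →
             (∀ u → u L.∈ vs → u ∈ (S - p) ─ N p) →
             (∀ u → u ∈ (S - p) ─ N p → u L.∈ vs) →
             Proc (NS S p) c₀ →
             ProcList S ⊥ vs c₁ →
             Proc S (∣ S ∣ * ∣ S ∣ + 1 + c₀ + c₁)

  data ProcList where
    []  : ∀ {S P} → ProcList S P [] 0
    _∷_ : ∀ {S P v vs c₁ c₂} →
          Proc (NS S v ─ P) c₁ →
          ProcList S (P ∪ ⁅ v ⁆) vs c₂ →
          ProcList S P (v ∷ vs) (c₁ + c₂)

  data ProcRoots : List (Fin n × Subset n) → ℕ → Set where
    []  : ProcRoots [] 0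
    _∷_ : ∀ {v S ord c₁ c₂} → Proc S c₁ → ProcRoots ord c₂ →
          ProcRoots ((v , S) ∷ ord) (c₁ + c₂)

  -- cost of the root step: computing the degeneracy orientation, O(n + m);
  -- we charge n + Σ_v deg(v) = n + 2m.
  rootCost : ℕ
  rootCost = n + sum (map (∣_∣ ∘ N) (allFin n))

  data SCTRun : List (Fin n × Subset n) → ℕ → Set where
    run : ∀ {ord c} → DegOrd ⊤ ord → ProcRoots ord c → SCTRun ord (rootCost + c)

-- A node whose label S has k = K + 1 vertices has the pivot child N(S, p), of some size d, and m
-- further children with m + d ≤ K, each of size at most d because the pivot has maximum degree in S.
-- For the shifted Moon–Moser function mm this gives (m + 1) · mm d ≤ mm k, and mm grows by a factor
-- of at least 4/3 per vertex; so by induction the subtree of the node costs at most κ · mm k − pot k,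
-- where the quadratic potential pot grows more slowly and the difference pays for the k² + 1 work at
-- the node. The n children of the root have size at most α, and the root step costs
-- n + Σ_v deg v = n + 2 Σ_v |N⁺(v)| ≤ n + 2nα; altogether O(n · 3^(α/3)).

module Submission where

open import Defs
open import Data.Nat using (ℕ; _*_; _^_; _/_; _≤_)
open import Data.Product using (∃)
open import Data.List using (List)
open import Data.Fin using (Fin)
open import Data.Fin.Subset using (Subset)
open import Data.Product using (_×_)

open import Data.Nat using (zero; suc; _+_; _<_; NonZero; >-nonZero; z≤n; s≤s)
open import Data.Nat.Properties
open import Data.Nat.DivMod using (m/n≡1+[m∸n]/n)
open import Data.Nat.Tactic.RingSolver using (solve-∀)
open import Data.Bool using (Bool; true; false; _∧_; not)
open import Data.Bool.Properties using (∧-comm; ∧-zeroʳ; ∧-identityʳ)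
open import Data.Empty using (⊥-elim)
open import Data.Fin using (zero; suc)
import Data.Fin.Properties as Fin
open import Data.Fin.Subset using (_∈_; _∉_; _⊆_; _∩_; _─_; _-_; ∣_∣; ⊥; ⊤; ⁅_⁆)
open import Data.Fin.Subset.Properties
  using ( ∣⊥∣≡0; ∣⊤∣≡n; ∈⊤; p⊆q⇒∣p∣≤∣q∣; x∈p∩q⁺; x∈p∩q⁻; p─q⊆p; ∣p─q∣≤∣p∣
        ; x∈p∧x≢y⇒x∈p-y; x∈p⇒∣p-x∣<∣p∣ )
open import Data.Vec using ([]; _∷_; lookup)
open import Data.Vec.Properties using (lookup-zipWith; lookup∘tabulate; []=⇒lookup; lookup-replicate)
open import Data.List using ([]; _∷_; length; map; allFin)
import Data.List as List
open import Data.List.Properties using (map-tabulate)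
open import Data.List.Membership.Propositional using () renaming (_∈_ to _∈ₗ_)
open import Data.List.Relation.Unary.Any using (here; there)
import Data.List.Relation.Unary.All as All
open import Data.List.Relation.Unary.Unique.Propositional using (Unique)
open import Data.List.Relation.Unary.AllPairs using ([]; _∷_)
open import Data.Nat.ListAction using () renaming (sum to sumList)
open import Algebra.Properties.CommutativeMonoid.Sum +-0-commutativeMonoid
  using (sum; ∑-distrib-+; sum-cong-≗; sum-replicate-zero)
open import Data.Product using (_,_; proj₂)
open import Data.Sum using (inj₁; inj₂)
open import Function using (_∘_; id)
open import Relation.Binary.PropositionalEquality
import Algebra.Properties.CommutativeSemigroup as CommutativeSemigroupProperties

module +-CS = CommutativeSemigroupProperties +-commutativeSemigroup
module *-CS = CommutativeSemigroupProperties *-commutativeSemigroup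

-- mm k = g (k + 2) for the Moon–Moser function g (g m = 3^(m/3), 4·3^((m-4)/3) or 2·3^((m-2)/3)
-- according to m mod 3).
mm : ℕ → ℕ
mm 0 = 2
mm 1 = 3
mm 2 = 4
mm (suc (suc (suc k))) = 3 * mm k

mm-pos : ∀ k → 0 < mm k
mm-pos 0 = s≤s z≤n
mm-pos 1 = s≤s z≤n
mm-pos 2 = s≤s z≤n
mm-pos (suc (suc (suc k))) = *-monoʳ-< 3 (mm-pos k)

mm-nonZero : ∀ k → NonZero (mm k)
mm-nonZero k = >-nonZero (mm-pos k)

mono-by-steps : (f : ℕ → ℕ) → (∀ k → f k ≤ f (suc k)) → ∀ {j k} → j ≤ k → f j ≤ f k
mono-by-steps f inc {_} {zero} z≤n = ≤-refl
mono-by-steps f inc {j} {suc k} j≤1+k with m≤n⇒m<n∨m≡n j≤1+k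
... | inj₁ (s≤s j≤k) = ≤-trans (mono-by-steps f inc j≤k) (inc k)
... | inj₂ refl = ≤-refl

ratio-antitone-by-steps : (f g : ℕ → ℕ) → (∀ k → NonZero (g k)) →
  (∀ k → f (suc k) * g k ≤ f k * g (suc k)) →
  ∀ {j k} → j ≤ k → f k * g j ≤ f j * g k
ratio-antitone-by-steps f g g≢0 inc {_} {zero} z≤n = ≤-refl
ratio-antitone-by-steps f g g≢0 inc {j} {suc k} j≤1+k with m≤n⇒m<n∨m≡n j≤1+k
... | inj₂ refl = ≤-refl
... | inj₁ (s≤s j≤k) = *-cancelʳ-≤ _ _ (g k) {{g≢0 k}} (begin
  f (suc k) * g j * g k  ≡⟨ *-CS.xy∙z≈xz∙y (f (suc k)) (g j) (g k) ⟩
  f (suc k) * g k * g j  ≤⟨ *-monoˡ-≤ (g j) (inc k) ⟩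
  f k * g (suc k) * g j  ≡⟨ *-CS.xy∙z≈xz∙y (f k) (g (suc k)) (g j) ⟩
  f k * g j * g (suc k)  ≤⟨ *-monoˡ-≤ (g (suc k)) (ratio-antitone-by-steps f g g≢0 inc j≤k) ⟩
  f j * g k * g (suc k)  ≡⟨ *-CS.xy∙z≈xz∙y (f j) (g k) (g (suc k)) ⟩
  f j * g (suc k) * g k  ∎)
  where open ≤-Reasoning

mm-mono : ∀ {j k} → j ≤ k → mm j ≤ mm k
mm-mono = mono-by-steps mm mm-step
  where
  mm-step : ∀ k → mm k ≤ mm (suc k)
  mm-step 0 = s≤s (s≤s z≤n)
  mm-step 1 = s≤s (s≤s (s≤s z≤n))
  mm-step 2 = s≤s (s≤s (s≤s (s≤s z≤n)))
  mm-step (suc (suc (suc k))) = *-monoʳ-≤ 3 (mm-step k)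

2*mm≤mm[2+] : ∀ d → 2 * mm d ≤ mm (2 + d)
2*mm≤mm[2+] 0 = ≤-refl
2*mm≤mm[2+] 1 = ≤-refl
2*mm≤mm[2+] 2 = s≤s (s≤s (s≤s (s≤s (s≤s (s≤s (s≤s (s≤s z≤n)))))))
2*mm≤mm[2+] (suc (suc (suc d))) = begin
  2 * (3 * mm d)  ≡⟨ *-CS.x∙yz≈y∙xz 2 3 (mm d) ⟩
  3 * (2 * mm d)  ≤⟨ *-monoʳ-≤ 3 (2*mm≤mm[2+] d) ⟩
  3 * mm (2 + d)  ∎
  where open ≤-Reasoning

4*mm≤3*mm[1+] : ∀ d → 4 * mm d ≤ 3 * mm (suc d)
4*mm≤3*mm[1+] 0 = s≤s (s≤s (s≤s (s≤s (s≤s (s≤s (s≤s (s≤s z≤n)))))))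
4*mm≤3*mm[1+] 1 = ≤-refl
4*mm≤3*mm[1+] 2 = m≤m+n 16 2
4*mm≤3*mm[1+] (suc (suc (suc d))) = begin
  4 * (3 * mm d)        ≡⟨ *-CS.x∙yz≈y∙xz 4 3 (mm d) ⟩
  3 * (4 * mm d)        ≤⟨ *-monoʳ-≤ 3 (4*mm≤3*mm[1+] d) ⟩
  3 * (3 * mm (suc d))  ∎
  where open ≤-Reasoning

mm-scale : ∀ s d → s * mm d ≤ mm (s + d)
mm-scale 0 d = z≤n
mm-scale 1 d rewrite *-identityˡ (mm d) = mm-mono (n≤1+n d)
mm-scale 2 d = 2*mm≤mm[2+] d
mm-scale 3 d = ≤-refl
mm-scale 4 d = 4*mm≤3*mm[1+] d
mm-scale (suc (suc (suc (suc (suc s))))) d = begin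
  (5 + s) * mm d        ≤⟨ *-monoˡ-≤ (mm d) 5+s≤3*[2+s] ⟩
  3 * (2 + s) * mm d    ≡⟨ *-assoc 3 (2 + s) (mm d) ⟩
  3 * ((2 + s) * mm d)  ≤⟨ *-monoʳ-≤ 3 (mm-scale (suc (suc s)) d) ⟩
  3 * mm (2 + s + d)    ∎
  where
  open ≤-Reasoning
  5+s≤3*[2+s] : 5 + s ≤ 3 * (2 + s)
  5+s≤3*[2+s] = ≤-trans (m≤m+n (5 + s) (1 + 2 * s)) (≤-reflexive (expand s))
    where
    expand : ∀ s → 5 + s + (1 + 2 * s) ≡ 3 * (2 + s)
    expand = solve-∀

mm≤4*3^[n/3] : ∀ a → mm a ≤ 4 * 3 ^ (a / 3)
mm≤4*3^[n/3] 0 = s≤s (s≤s z≤n)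
mm≤4*3^[n/3] 1 = s≤s (s≤s (s≤s z≤n))
mm≤4*3^[n/3] 2 = ≤-refl
mm≤4*3^[n/3] (suc (suc (suc a))) rewrite m/n≡1+[m∸n]/n {3 + a} {3} (s≤s (s≤s (s≤s z≤n))) = begin
  3 * mm a                ≤⟨ *-monoʳ-≤ 3 (mm≤4*3^[n/3] a) ⟩
  3 * (4 * 3 ^ (a / 3))   ≡⟨ *-CS.x∙yz≈y∙xz 3 4 (3 ^ (a / 3)) ⟩
  4 * (3 * 3 ^ (a / 3))   ∎
  where open ≤-Reasoning

n≤3*3^[n/3] : ∀ a → a ≤ 3 * 3 ^ (a / 3)
n≤3*3^[n/3] 0 = z≤n
n≤3*3^[n/3] 1 = s≤s z≤n
n≤3*3^[n/3] 2 = s≤s (s≤s z≤n)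
n≤3*3^[n/3] (suc (suc (suc a))) rewrite m/n≡1+[m∸n]/n {3 + a} {3} (s≤s (s≤s (s≤s z≤n))) = begin
  3 + a          ≤⟨ +-mono-≤ (*-monoʳ-≤ 3 (m^n>0 3 (a / 3))) (n≤3*3^[n/3] a) ⟩
  3 * P + 3 * P  ≤⟨ m≤m+n (3 * P + 3 * P) (3 * P) ⟩
  3 * P + 3 * P + 3 * P  ≡⟨ thrice P ⟩
  3 * (3 * P)    ∎
  where
  open ≤-Reasoning
  P = 3 ^ (a / 3)
  thrice : ∀ x → 3 * x + 3 * x + 3 * x ≡ 3 * (3 * x)
  thrice = solve-∀

pot : ℕ → ℕ
pot k = 4 * ((k + 25) * (k + 25))

-- κ exceeds the largest ratio pot k / mm k = pot 0 / mm 0 = 1250 by the cost of a leaf.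
κ : ℕ
κ = 1251

pot-step : ∀ k → 3 * pot (suc k) + 3 * (suc k * suc k + 1) ≤ 4 * pot k
pot-step k = begin
  3 * pot (suc k) + 3 * (suc k * suc k + 1)                            ≤⟨ m≤m+n _ (k * k + 170 * k + 1882) ⟩
  3 * pot (suc k) + 3 * (suc k * suc k + 1) + (k * k + 170 * k + 1882)  ≡⟨ expand k ⟩
  4 * pot k                                                            ∎
  where
  open ≤-Reasoning
  expand : ∀ k → 3 * (4 * ((suc k + 25) * (suc k + 25))) + 3 * (suc k * suc k + 1) + (k * k + 170 * k + 1882)
                 ≡ 4 * (4 * ((k + 25) * (k + 25)))
  expand = solve-∀

node-slack : ∀ K → (suc K * suc K + 1 + pot (suc K)) * mm K ≤ mm (suc K) * pot K
node-slack K = *-cancelˡ-≤ 3 (begin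
  3 * ((w + pot (suc K)) * mm K)    ≡⟨ distribute w (pot (suc K)) (mm K) ⟩
  (3 * pot (suc K) + 3 * w) * mm K  ≤⟨ *-monoˡ-≤ (mm K) (pot-step K) ⟩
  4 * pot K * mm K                  ≡⟨ *-CS.xy∙z≈y∙xz 4 (pot K) (mm K) ⟩
  pot K * (4 * mm K)                ≤⟨ *-monoʳ-≤ (pot K) (4*mm≤3*mm[1+] K) ⟩
  pot K * (3 * mm (suc K))          ≡⟨ *-CS.x∙yz≈y∙zx (pot K) 3 (mm (suc K)) ⟩
  3 * (mm (suc K) * pot K)          ∎)
  where
  open ≤-Reasoning
  w = suc K * suc K + 1
  distribute : ∀ a v e → 3 * ((a + v) * e) ≡ (3 * v + 3 * a) * e
  distribute = solve-∀

pot/mm-antitone : ∀ {j k} → j ≤ k → pot k * mm j ≤ pot j * mm k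
pot/mm-antitone = ratio-antitone-by-steps pot mm mm-nonZero λ k → begin
  pot (suc k) * mm k                            ≤⟨ *-monoˡ-≤ (mm k) (m≤n+m (pot (suc k)) (suc k * suc k + 1)) ⟩
  (suc k * suc k + 1 + pot (suc k)) * mm k      ≤⟨ node-slack k ⟩
  mm (suc k) * pot k                            ≡⟨ *-comm (mm (suc k)) (pot k) ⟩
  pot k * mm (suc k)                            ∎
  where open ≤-Reasoning

pot≤κ*mm : ∀ k → pot k ≤ κ * mm k
pot≤κ*mm k = ≤-trans (*-cancelʳ-≤ (pot k) (1250 * mm k) 2 (begin
  pot k * 2          ≤⟨ pot/mm-antitone {0} {k} z≤n ⟩
  2500 * mm k        ≡⟨ *-CS.xy∙z≈xz∙y 1250 2 (mm k) ⟩
  1250 * mm k * 2    ∎)) (*-monoˡ-≤ (mm k) (n≤1+n 1250))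
  where open ≤-Reasoning

-- Affordable K X a is the rational inequality a ≤ X * (κ - pot K / mm K), denominators cleared.
record Affordable (K X a : ℕ) : Set where
  constructor affordable
  field bound : a * mm K + X * pot K ≤ X * (κ * mm K)

affordable-+ : ∀ {K X Y a b} → Affordable K X a → Affordable K Y b → Affordable K (X + Y) (a + b)
affordable-+ {K} {X} {Y} {a} {b} (affordable ha) (affordable hb) = affordable (begin
  (a + b) * mm K + (X + Y) * pot K                  ≡⟨ interchange a b X Y (mm K) (pot K) ⟩
  (a * mm K + X * pot K) + (b * mm K + Y * pot K)   ≤⟨ +-mono-≤ ha hb ⟩
  X * (κ * mm K) + Y * (κ * mm K)                   ≡⟨ *-distribʳ-+ (κ * mm K) X Y ⟨
  (X + Y) * (κ * mm K)                              ∎)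
  where
  open ≤-Reasoning
  interchange : ∀ a b X Y e v → (a + b) * e + (X + Y) * v ≡ (a * e + X * v) + (b * e + Y * v)
  interchange = solve-∀

affordable-0 : ∀ K X → Affordable K X 0
affordable-0 K X = affordable (*-monoʳ-≤ X (pot≤κ*mm K))

affordable-mono : ∀ {K X Y a} → X ≤ Y → Affordable K X a → Affordable K Y a
affordable-mono {K} {X} {a = a} X≤Y h with m≤n⇒∃[o]m+o≡n X≤Y
... | t , refl = subst (λ b → Affordable K (X + t) b) (+-identityʳ a) (affordable-+ h (affordable-0 K t))

affordable-child : ∀ {K d c} → d ≤ K → c + pot d ≤ κ * mm d → Affordable K (mm d) c
affordable-child {K} {d} {c} d≤K h = affordable (begin
  c * mm K + mm d * pot K   ≡⟨ cong (c * mm K +_) (*-comm (mm d) (pot K)) ⟩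
  c * mm K + pot K * mm d   ≤⟨ +-monoʳ-≤ (c * mm K) (pot/mm-antitone d≤K) ⟩
  c * mm K + pot d * mm K   ≡⟨ *-distribʳ-+ (mm K) c (pot d) ⟨
  (c + pot d) * mm K        ≤⟨ *-monoˡ-≤ (mm K) h ⟩
  κ * mm d * mm K           ≡⟨ *-CS.xy∙z≈y∙xz κ (mm d) (mm K) ⟩
  mm d * (κ * mm K)         ∎)
  where open ≤-Reasoning

affordable-node : ∀ {K c} → Affordable K (mm (suc K)) c →
                  suc K * suc K + 1 + c + pot (suc K) ≤ κ * mm (suc K)
affordable-node {K} {c} (affordable h) = *-cancelʳ-≤ _ _ (mm K) {{mm-nonZero K}} (begin
  (w + c + pot (suc K)) * mm K            ≡⟨ regroup w c (pot (suc K)) (mm K) ⟩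
  (w + pot (suc K)) * mm K + c * mm K     ≤⟨ +-monoˡ-≤ (c * mm K) (node-slack K) ⟩
  mm (suc K) * pot K + c * mm K           ≡⟨ +-comm (mm (suc K) * pot K) (c * mm K) ⟩
  c * mm K + mm (suc K) * pot K           ≤⟨ h ⟩
  mm (suc K) * (κ * mm K)                 ≡⟨ *-CS.x∙yz≈yx∙z (mm (suc K)) κ (mm K) ⟩
  κ * mm (suc K) * mm K                   ∎)
  where
  open ≤-Reasoning
  w = suc K * suc K + 1
  regroup : ∀ a c v e → (a + c + v) * e ≡ (a + v) * e + c * e
  regroup = solve-∀

branch-cost : ∀ {K d m c₀ c₁} → m + d ≤ K → c₀ + pot d ≤ κ * mm d → Affordable K (m * mm d) c₁ →
              suc K * suc K + 1 + c₀ + c₁ + pot (suc K) ≤ κ * mm (suc K)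
branch-cost {K} {d} {m} {c₀} {c₁} m+d≤K h₀ h₁ =
  subst (λ c → c + pot (suc K) ≤ κ * mm (suc K)) (sym (+-assoc (suc K * suc K + 1) c₀ c₁))
        (affordable-node (affordable-mono children≤ (affordable-+ (affordable-child d≤K h₀) h₁)))
  where
  d≤K : d ≤ K
  d≤K = ≤-trans (m≤n+m d m) m+d≤K
  children≤ : suc m * mm d ≤ mm (suc K)
  children≤ = ≤-trans (mm-scale (suc m) d) (mm-mono (s≤s m+d≤K))

χ : Bool → ℕ
χ true = 1
χ false = 0

χ*≤ : ∀ b x → χ b * x ≤ x
χ*≤ true x = ≤-reflexive (+-identityʳ x)
χ*≤ false x = z≤n

sum-mono : ∀ {n} {f g : Fin n → ℕ} → (∀ i → f i ≤ g i) → sum f ≤ sum g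
sum-mono {zero} f≤g = z≤n
sum-mono {suc n} f≤g = +-mono-≤ (f≤g zero) (sum-mono (f≤g ∘ suc))

sum-≤-except : ∀ {n} {f g : Fin n → ℕ} v → (∀ i → i ≢ v → f i ≤ g i) → sum f ≤ f v + sum g
sum-≤-except {suc n} {f} {g} zero f≤g =
  +-monoʳ-≤ (f zero) (≤-trans (sum-mono (λ i → f≤g (suc i) (λ ()))) (m≤n+m _ (g zero)))
sum-≤-except {suc n} {f} {g} (suc v) f≤g = begin
  f zero + sum (f ∘ suc)
    ≤⟨ +-mono-≤ (f≤g zero (λ ())) (sum-≤-except v λ i i≢v → f≤g (suc i) (i≢v ∘ Fin.suc-injective)) ⟩
  g zero + (f (suc v) + sum (g ∘ suc))
    ≡⟨ +-CS.x∙yz≈y∙xz (g zero) (f (suc v)) (sum (g ∘ suc)) ⟩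
  f (suc v) + (g zero + sum (g ∘ suc))
    ∎
  where open ≤-Reasoning

sumList-tabulate : ∀ {n} (f : Fin n → ℕ) → sumList (List.tabulate f) ≡ sum f
sumList-tabulate {zero} f = refl
sumList-tabulate {suc n} f = cong (f zero +_) (sumList-tabulate (f ∘ suc))

∣p∣≡∑χ : ∀ {n} (p : Subset n) → ∣ p ∣ ≡ sum (χ ∘ lookup p)
∣p∣≡∑χ [] = refl
∣p∣≡∑χ (true ∷ p) = cong suc (∣p∣≡∑χ p)
∣p∣≡∑χ (false ∷ p) = ∣p∣≡∑χ p

lookup-─ : ∀ {n} (p q : Subset n) i → lookup (p ─ q) i ≡ lookup p i ∧ not (lookup q i)
lookup-─ (x ∷ p) (true ∷ q) zero = sym (∧-zeroʳ x)
lookup-─ (x ∷ p) (false ∷ q) zero = sym (∧-identityʳ x)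
lookup-─ (x ∷ p) (y ∷ q) (suc i) = lookup-─ p q i

lookup-⁅⁆ : ∀ {n} {i j : Fin n} → i ≢ j → lookup ⁅ j ⁆ i ≡ false
lookup-⁅⁆ {i = zero} {zero} i≢j = ⊥-elim (i≢j refl)
lookup-⁅⁆ {suc n} {suc i} {zero} i≢j = lookup-replicate i false
lookup-⁅⁆ {i = zero} {suc j} i≢j = refl
lookup-⁅⁆ {i = suc i} {suc j} i≢j = lookup-⁅⁆ (i≢j ∘ cong suc)

lookup-remove : ∀ {n} (p : Subset n) {i j} → i ≢ j → lookup (p - j) i ≡ lookup p i
lookup-remove p {i} {j} i≢j rewrite lookup-─ p ⁅ j ⁆ i | lookup-⁅⁆ i≢j = ∧-identityʳ (lookup p i)

∣p─q∣+∣p∩q∣≡∣p∣ : ∀ {n} (p q : Subset n) → ∣ p ─ q ∣ + ∣ p ∩ q ∣ ≡ ∣ p ∣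
∣p─q∣+∣p∩q∣≡∣p∣ [] [] = refl
∣p─q∣+∣p∩q∣≡∣p∣ (true ∷ p) (true ∷ q) = trans (+-suc _ _) (cong suc (∣p─q∣+∣p∩q∣≡∣p∣ p q))
∣p─q∣+∣p∩q∣≡∣p∣ (true ∷ p) (false ∷ q) = cong suc (∣p─q∣+∣p∩q∣≡∣p∣ p q)
∣p─q∣+∣p∩q∣≡∣p∣ (false ∷ p) (true ∷ q) = ∣p─q∣+∣p∩q∣≡∣p∣ p q
∣p─q∣+∣p∩q∣≡∣p∣ (false ∷ p) (false ∷ q) = ∣p─q∣+∣p∩q∣≡∣p∣ p q

length≤∣p∣ : ∀ {n} {xs : List (Fin n)} {p : Subset n} →
             Unique xs → (∀ {x} → x ∈ₗ xs → x ∈ p) → length xs ≤ ∣ p ∣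
length≤∣p∣ {xs = []} _ _ = z≤n
length≤∣p∣ {xs = x ∷ xs} {p} (x∉xs ∷ xs!) xs⊆p =
  ≤-trans (s≤s (length≤∣p∣ {p = p - x} xs! xs⊆p-x)) (x∈p⇒∣p-x∣<∣p∣ (xs⊆p (here refl)))
  where
  xs⊆p-x : ∀ {y} → y ∈ₗ xs → y ∈ p - x
  xs⊆p-x y∈xs = x∈p∧x≢y⇒x∈p-y (xs⊆p (there y∈xs)) (λ { refl → All.lookup x∉xs y∈xs refl })

module _ {n : ℕ} (G : Graph n) where

  lookup-NS : ∀ S v w → lookup (NS G S v) w ≡ adj G v w ∧ lookup S w
  lookup-NS S v w rewrite lookup-zipWith _∧_ w (N G v) S | lookup∘tabulate (adj G v) w = refl

  v∉N[v] : ∀ v → v ∉ N G v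
  v∉N[v] v v∈N[v] with trans (sym ([]=⇒lookup v∈N[v])) (lookup∘tabulate (adj G v) v)
  ... | eq rewrite adj-irr G v with eq
  ... | ()

  NS⊆[S-v]∩N : ∀ S v → NS G S v ⊆ (S - v) ∩ N G v
  NS⊆[S-v]∩N S v {x} x∈NS with x∈p∩q⁻ (N G v) S x∈NS
  ... | x∈N , x∈S = x∈p∩q⁺ (x∈p∧x≢y⇒x∈p-y x∈S (λ { refl → v∉N[v] v x∈N }) , x∈N)

  -- The pivot p and the vertices v₁, …, v_ℓ lie in the disjoint sets {p}, (S - p) ∩ N(p), (S - p) ─ N(p).
  pivot-split : ∀ {S p vs} → p ∈ S → Unique vs → (∀ {u} → u ∈ₗ vs → u ∈ (S - p) ─ N G p) →
                suc (length vs + ∣ NS G S p ∣) ≤ ∣ S ∣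
  pivot-split {S} {p} {vs} p∈S vs! vs⊆ = begin-strict
    length vs + ∣ NS G S p ∣                   ≤⟨ +-mono-≤ (length≤∣p∣ vs! vs⊆) (p⊆q⇒∣p∣≤∣q∣ (NS⊆[S-v]∩N S p)) ⟩
    ∣ (S - p) ─ N G p ∣ + ∣ (S - p) ∩ N G p ∣   ≡⟨ ∣p─q∣+∣p∩q∣≡∣p∣ (S - p) (N G p) ⟩
    ∣ S - p ∣                                  <⟨ x∈p⇒∣p-x∣<∣p∣ p∈S ⟩
    ∣ S ∣                                      ∎
    where open ≤-Reasoning

  mutual
    proc-cost : ∀ {S c} → Proc G S c → c + pot ∣ S ∣ ≤ κ * mm ∣ S ∣
    proc-cost leaf rewrite ∣⊥∣≡0 n = n≤1+n 2501
    proc-cost {S} (branch {c₀ = c₀} {c₁} p p∈S p-max vs vs! vs⊆ _ pivot-child others)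
      with ∣ S ∣ | pivot-split p∈S vs! (λ {u} → vs⊆ u)
    ... | suc K | s≤s m+d≤K =
      branch-cost {d = ∣ NS G S p ∣} {m = length vs} m+d≤K (proc-cost pivot-child)
        (children-affordable (≤-trans (m≤n+m _ _) m+d≤K) (λ {u} u∈vs → p-max u (vs⊆S u∈vs)) others)
      where
      vs⊆S : ∀ {u} → u ∈ₗ vs → u ∈ S
      vs⊆S {u} u∈vs = p─q⊆p S ⁅ p ⁆ (p─q⊆p (S - p) (N G p) (vs⊆ u u∈vs))

    children-affordable : ∀ {S P vs c d K} → d ≤ K → (∀ {u} → u ∈ₗ vs → ∣ NS G S u ∣ ≤ d) →
                          ProcList G S P vs c → Affordable K (length vs * mm d) c
    children-affordable {K = K} d≤K vs≤d [] = affordable-0 K 0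
    children-affordable {S} {P} {v ∷ vs} {d = d} d≤K vs≤d (child ∷ others) =
      affordable-+ (affordable-mono (mm-mono child≤d) (affordable-child (≤-trans child≤d d≤K) (proc-cost child)))
                   (children-affordable d≤K (vs≤d ∘ there) others)
      where
      child≤d : ∣ NS G S v ─ P ∣ ≤ d
      child≤d = ≤-trans (∣p─q∣≤∣p∣ (NS G S v) P) (vs≤d (here refl))

  -- Σ_{u ∈ R} |N(u) ∩ R|, i.e. twice the number of edges of the subgraph induced on R.
  innerDegSum : Subset n → ℕ
  innerDegSum R = sum λ u → χ (lookup R u) * ∣ NS G R u ∣

  ∑χ-neighbour≡∣NS∣ : ∀ R v → sum (λ u → χ (lookup R u ∧ adj G u v)) ≡ ∣ NS G R v ∣
  ∑χ-neighbour≡∣NS∣ R v = sym (trans (∣p∣≡∑χ (NS G R v)) (sum-cong-≗ λ u → cong χ (begin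
    lookup (NS G R v) u      ≡⟨ lookup-NS R v u ⟩
    adj G v u ∧ lookup R u   ≡⟨ cong (_∧ lookup R u) (adj-sym G v u) ⟩
    adj G u v ∧ lookup R u   ≡⟨ ∧-comm (adj G u v) (lookup R u) ⟩
    lookup R u ∧ adj G u v   ∎)))
    where open ≡-Reasoning

  ∣NS∣≤χ+∣NS-remove∣ : ∀ R v u → ∣ NS G R u ∣ ≤ χ (adj G u v) + ∣ NS G (R - v) u ∣
  ∣NS∣≤χ+∣NS-remove∣ R v u = begin
    ∣ NS G R u ∣
      ≡⟨ ∣p∣≡∑χ (NS G R u) ⟩
    sum (χ ∘ lookup (NS G R u))
      ≤⟨ sum-≤-except v (λ w w≢v → ≤-reflexive (cong χ (same w w≢v))) ⟩
    χ (lookup (NS G R u) v) + sum (χ ∘ lookup (NS G (R - v) u))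
      ≤⟨ +-monoˡ-≤ _ at-v ⟩
    χ (adj G u v) + sum (χ ∘ lookup (NS G (R - v) u))
      ≡⟨ cong (χ (adj G u v) +_) (∣p∣≡∑χ (NS G (R - v) u)) ⟨
    χ (adj G u v) + ∣ NS G (R - v) u ∣
      ∎
    where
    open ≤-Reasoning
    same : ∀ w → w ≢ v → lookup (NS G R u) w ≡ lookup (NS G (R - v) u) w
    same w w≢v rewrite lookup-NS R u w | lookup-NS (R - v) u w | lookup-remove R w≢v = refl
    at-v : χ (lookup (NS G R u) v) ≤ χ (adj G u v)
    at-v rewrite lookup-NS R u v with adj G u v | lookup R v
    ... | true  | true  = ≤-refl
    ... | true  | false = z≤n
    ... | false | _     = z≤n

  innerDegSum-summand-remove : ∀ R v u → u ≢ v →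
    χ (lookup R u) * ∣ NS G R u ∣ ≤ χ (lookup (R - v) u) * ∣ NS G (R - v) u ∣ + χ (lookup R u ∧ adj G u v)
  innerDegSum-summand-remove R v u u≢v rewrite lookup-remove R u≢v with lookup R u
  ... | false = z≤n
  ... | true rewrite +-identityʳ ∣ NS G R u ∣ | +-identityʳ ∣ NS G (R - v) u ∣ =
    ≤-trans (∣NS∣≤χ+∣NS-remove∣ R v u) (≤-reflexive (+-comm (χ (adj G u v)) _))

  innerDegSum-remove : ∀ R v → innerDegSum R ≤ innerDegSum (R - v) + 2 * ∣ NS G R v ∣
  innerDegSum-remove R v = begin
    innerDegSum R                                  ≤⟨ sum-≤-except v (innerDegSum-summand-remove R v) ⟩
    χ (lookup R v) * d + sum (λ u → rest u + toV u)  ≡⟨ cong (χ (lookup R v) * d +_) (∑-distrib-+ rest toV) ⟩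
    χ (lookup R v) * d + (sum rest + sum toV)      ≡⟨ cong (λ e → χ (lookup R v) * d + (sum rest + e)) (∑χ-neighbour≡∣NS∣ R v) ⟩
    χ (lookup R v) * d + (innerDegSum (R - v) + d)  ≤⟨ +-monoˡ-≤ _ (χ*≤ (lookup R v) d) ⟩
    d + (innerDegSum (R - v) + d)                  ≡⟨ regroup d (innerDegSum (R - v)) ⟩
    innerDegSum (R - v) + 2 * d                    ∎
    where
    open ≤-Reasoning
    d = ∣ NS G R v ∣
    rest toV : Fin n → ℕ
    rest u = χ (lookup (R - v) u) * ∣ NS G (R - v) u ∣
    toV u = χ (lookup R u ∧ adj G u v)
    regroup : ∀ a b → a + (b + a) ≡ b + 2 * a
    regroup = solve-∀

  outDegSum : List (Fin n × Subset n) → ℕ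
  outDegSum ord = sumList (map (∣_∣ ∘ proj₂) ord)

  innerDegSum≤2*outDegSum : ∀ {R ord} → DegOrd G R ord → innerDegSum R ≤ 2 * outDegSum ord
  innerDegSum≤2*outDegSum done = ≤-reflexive (trans (sum-cong-≗ outside-⊥) (sum-replicate-zero n))
    where
    outside-⊥ : ∀ u → χ (lookup ⊥ u) * ∣ NS G ⊥ u ∣ ≡ 0
    outside-⊥ u = cong (λ b → χ b * ∣ NS G ⊥ u ∣) (lookup-replicate u false)
  innerDegSum≤2*outDegSum {R} (next {ord = ord} v _ _ rest) = begin
    innerDegSum R                          ≤⟨ innerDegSum-remove R v ⟩
    innerDegSum (R - v) + 2 * d            ≤⟨ +-monoˡ-≤ _ (innerDegSum≤2*outDegSum rest) ⟩
    2 * outDegSum ord + 2 * d              ≡⟨ regroup (outDegSum ord) d ⟩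
    2 * (d + outDegSum ord)                ∎
    where
    open ≤-Reasoning
    d = ∣ NS G R v ∣
    regroup : ∀ a b → 2 * a + 2 * b ≡ 2 * (b + a)
    regroup = solve-∀

  outDegSum≤length* : ∀ ord {a} → maxOutDeg G ord ≤ a → outDegSum ord ≤ length ord * a
  outDegSum≤length* [] _ = z≤n
  outDegSum≤length* ((v , S) ∷ ord) h =
    +-mono-≤ (m⊔n≤o⇒m≤o ∣ S ∣ _ h) (outDegSum≤length* ord (m⊔n≤o⇒n≤o ∣ S ∣ _ h))

  length≤∣R∣ : ∀ {R ord} → DegOrd G R ord → length ord ≤ ∣ R ∣
  length≤∣R∣ done = z≤n
  length≤∣R∣ (next v v∈R _ rest) = ≤-trans (s≤s (length≤∣R∣ rest)) (x∈p⇒∣p-x∣<∣p∣ v∈R)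

  length≤n : ∀ {ord} → DegOrd G ⊤ ord → length ord ≤ n
  length≤n degOrd = ≤-trans (length≤∣R∣ degOrd) (≤-reflexive (∣⊤∣≡n n))

  rootCost≤ : ∀ {ord} → DegOrd G ⊤ ord → rootCost G ≤ n + 2 * (n * maxOutDeg G ord)
  rootCost≤ {ord} degOrd = +-monoʳ-≤ n (begin
    sumList (map (∣_∣ ∘ N G) (allFin n))       ≡⟨ cong sumList (map-tabulate id (∣_∣ ∘ N G)) ⟩
    sumList (List.tabulate (∣_∣ ∘ N G))        ≡⟨ sumList-tabulate (∣_∣ ∘ N G) ⟩
    sum (∣_∣ ∘ N G)                            ≤⟨ sum-mono deg≤summand ⟩
    innerDegSum ⊤                              ≤⟨ innerDegSum≤2*outDegSum degOrd ⟩
    2 * outDegSum ord                          ≤⟨ *-monoʳ-≤ 2 (outDegSum≤length* ord ≤-refl) ⟩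
    2 * (length ord * maxOutDeg G ord)         ≤⟨ *-monoʳ-≤ 2 (*-monoˡ-≤ _ (length≤n degOrd)) ⟩
    2 * (n * maxOutDeg G ord)                  ∎)
    where
    open ≤-Reasoning
    deg≤summand : ∀ u → ∣ N G u ∣ ≤ χ (lookup ⊤ u) * ∣ NS G ⊤ u ∣
    deg≤summand u rewrite lookup-replicate {n = n} u true | +-identityʳ ∣ NS G ⊤ u ∣ =
      p⊆q⇒∣p∣≤∣q∣ {p = N G u} {q = NS G ⊤ u} (λ x∈N → x∈p∩q⁺ (x∈N , ∈⊤))

  rootsCost≤length* : ∀ {ord c a} → ProcRoots G ord c → maxOutDeg G ord ≤ a → c ≤ length ord * (κ * mm a)
  rootsCost≤length* [] _ = z≤n
  rootsCost≤length* (_∷_ {S = S} root roots) h =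
    +-mono-≤ (≤-trans (m≤m+n _ _) (≤-trans (proc-cost root) (*-monoʳ-≤ κ (mm-mono (m⊔n≤o⇒m≤o ∣ S ∣ _ h)))))
             (rootsCost≤length* roots (m⊔n≤o⇒n≤o ∣ S ∣ _ h))

  rootsCost≤ : ∀ {ord c} → DegOrd G ⊤ ord → ProcRoots G ord c → c ≤ n * (κ * mm (maxOutDeg G ord))
  rootsCost≤ degOrd roots = ≤-trans (rootsCost≤length* roots ≤-refl) (*-monoˡ-≤ _ (length≤n degOrd))

cost≤5011*n*3^[α/3] : ∀ n α → n + 2 * (n * α) + n * (κ * mm α) ≤ 5011 * (n * 3 ^ (α / 3))
cost≤5011*n*3^[α/3] n α = begin
  n + 2 * (n * α) + n * (κ * mm α)
    ≤⟨ +-mono-≤ (+-mono-≤ n≤n*P (*-monoʳ-≤ 2 (*-monoʳ-≤ n (n≤3*3^[n/3] α))))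
                (*-monoʳ-≤ n (*-monoʳ-≤ κ (mm≤4*3^[n/3] α))) ⟩
  n * P + 2 * (n * (3 * P)) + n * (1251 * (4 * P))
    ≡⟨ collect n P ⟩
  5011 * (n * P)
    ∎
  where
  open ≤-Reasoning
  P = 3 ^ (α / 3)
  n≤n*P : n ≤ n * P
  n≤n*P = ≤-trans (≤-reflexive (sym (*-identityʳ n))) (*-monoʳ-≤ n (m^n>0 3 (α / 3)))
  collect : ∀ n P → n * P + 2 * (n * (3 * P)) + n * (1251 * (4 * P)) ≡ 5011 * (n * P)
  collect = solve-∀

mainTheorem2 : ∃ λ (C : ℕ) →
    ∀ (n : ℕ) (G : Graph n) → Connected G →
    ∀ (ord : List (Fin n × Subset n)) (c : ℕ) → SCTRun G ord c →
    c ≤ C * (n * 3 ^ (maxOutDeg G ord / 3))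
mainTheorem2 = 5011 , λ where
  n G _ ord _ (run degOrd roots) →
    ≤-trans (+-mono-≤ (rootCost≤ G degOrd) (rootsCost≤ G degOrd roots)) (cost≤5011*n*3^[α/3] n (maxOutDeg G ord))
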